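{- Let $n\geq 4$ and $k$ be positive integers, let $\pi$ be a function assigning to each size-$n$ multiset $S$ of $[k]$ a permutation $\pi(S)$ of $S$, with maximum distortion at most $3$. Let $K'\subseteq[k]$ and suppose every $(n-1)$-element subset $R\subseteq K'$ is semi-frozen, and fix for each such $R$ a semi-freezing function $h_R$ and wildcard index $w_R$. Then for every $(n-2)$-element set $Q\subset K'$ and every pair of $(n-1)$-element sets $R,R'$ with $Q\subset R\subseteq K'$ and $Q\subset R'\subseteq K'$, there exists $T\subset Q$ with $|T|=n-4$ such that $h_R(t)=h_{R'}(t)$ for every $t\in T$.
   Context: For strings $X$ of length $n$, $X[i]$ denotes the $i$-th character, $i\in[n]$. The maximum distortion of $\pi$ is the maximum Hamming distance $d(\pi(S),\pi(S'))$ over all pairs of size-$n$ multisets $S,S'$ of $[k]$ whose multiset symmetric difference has size $2$. For $R\subseteq[k]$, $\mathcal U_R$ is the family of all sets $S\subseteq[k]$ with $R\subset S$ and $|S|=|R|+1$. An $(n-1)$-element set $R\subset[k]$ is semi-frozen with semi-freezing function $h_R$ and wildcard index $w_R$ if $h_R:R\to[n]$ is one-to-one, $w_R$ is the unique index of $[n]$ not in the image of $h_R$, and for every $r\in R$ and every $S\in\mathcal U_R$, either $\pi(S)[h_R(r)]=r$ or $\pi(S)[w_R]=r$. -}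

module Defs where

open import Data.Nat using (ℕ; zero; suc; _+_; _≤_; _∸_; ∣_-_∣)
open import Data.Bool using (Bool; true; false; if_then_else_)
open import Data.Fin using (Fin)
open import Data.Fin.Properties using (_≟_)
open import Data.Fin.Subset using (Subset; _∈_; _⊆_; ∣_∣)
open import Data.Vec using (Vec; []; _∷_; lookup; map; sum; zipWith)
open import Data.Product using (_×_)
open import Data.Sum using (_⊎_)
open import Relation.Nullary using (¬_; yes; no)
open import Relation.Binary.PropositionalEquality using (_≡_; _≢_)

Multiset : ℕ → Set
Multiset k = Vec ℕ k

size : ∀ {k} → Multiset k → ℕ
size = sum

Str : ℕ → ℕ → Set
Str k n = Vec (Fin k) n

occ : ∀ {k n} → Fin k → Str k n → ℕ
occ c [] = 0
occ c (x ∷ xs) with x ≟ c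
... | yes _ = suc (occ c xs)
... | no  _ = occ c xs

hamming : ∀ {k n} → Str k n → Str k n → ℕ
hamming [] [] = 0
hamming (x ∷ xs) (y ∷ ys) with x ≟ y
... | yes _ = hamming xs ys
... | no  _ = suc (hamming xs ys)

symDiff : ∀ {k} → Multiset k → Multiset k → ℕ
symDiff S S' = sum (zipWith ∣_-_∣ S S')

IsPermAssignment : ∀ {k} n → (Multiset k → Str k n) → Set
IsPermAssignment {k} n π =
  ∀ (S : Multiset k) → size S ≡ n → ∀ (c : Fin k) → occ c (π S) ≡ lookup S c

MaxDistortionAtMost : ∀ {k n} → (Multiset k → Str k n) → ℕ → Set
MaxDistortionAtMost {k} {n} π d =
  ∀ (S S' : Multiset k) → size S ≡ n → size S' ≡ n → symDiff S S' ≡ 2 →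
  hamming (π S) (π S') ≤ d

toMultiset : ∀ {k} → Subset k → Multiset k
toMultiset = map (λ b → if b then 1 else 0)

-- R is semi-frozen (w.r.t. π) with semi-freezing function h (values
-- outside R are irrelevant) and wildcard index w.
SemiFrozenWith : ∀ {k n} → (Multiset k → Str k n) →
                 Subset k → (Fin k → Fin n) → Fin n → Set
SemiFrozenWith {k} {n} π R h w =
  (∀ r r' → r ∈ R → r' ∈ R → h r ≡ h r' → r ≡ r') ×
  -- w is not in the image of h on R (unique such index since |R| = n - 1)
  (∀ r → r ∈ R → h r ≢ w) ×
  (∀ r → r ∈ R → ∀ (S : Subset k) → R ⊆ S → ∣ S ∣ ≡ suc ∣ R ∣ →
     lookup (π (toMultiset S)) (h r) ≡ r ⊎ lookup (π (toMultiset S)) w ≡ r)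

-- Put S = R ∪ R'. If R ≠ R' then R ∩ R' = Q, so |S| = n and S lies in both
-- U_R and U_R'. Every t ∈ Q occurs exactly once in π(S); unless t is one of
-- the two letters sitting at the wildcard positions w_R, w_R' of π(S), the
-- semi-freezing property places it at h_R(t) and at h_R'(t), which must
-- therefore coincide. Discarding those two letters from Q leaves n - 4.
module Submission where

open import Defs
open import Data.Nat using (ℕ; zero; suc; _+_; _≤_; _∸_; z≤n; s≤s)
open import Data.Nat.Properties hiding (_≟_)
open import Data.Bool using (true; false)
open import Data.Fin using (Fin; zero; suc)
open import Data.Fin.Properties using (_≟_)
open import Data.Fin.Subset
open import Data.Fin.Subset.Properties
open import Data.Vec using ([]; _∷_; lookup; here; there)
open import Data.Product using (Σ; _×_; _,_)
open import Data.Sum using (_⊎_; inj₁; inj₂)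
open import Data.Empty using (⊥-elim)
open import Function using (_∘_)
open import Relation.Nullary using (yes; no; contradiction)
open import Relation.Binary.PropositionalEquality

∣p∩q∣+∣p∪q∣≡∣p∣+∣q∣ : ∀ {n} (p q : Subset n) → ∣ p ∩ q ∣ + ∣ p ∪ q ∣ ≡ ∣ p ∣ + ∣ q ∣
∣p∩q∣+∣p∪q∣≡∣p∣+∣q∣ [] [] = refl
∣p∩q∣+∣p∪q∣≡∣p∣+∣q∣ (true ∷ p) (true ∷ q) =
  cong suc (trans (+-suc _ _) (trans (cong suc (∣p∩q∣+∣p∪q∣≡∣p∣+∣q∣ p q)) (sym (+-suc _ _))))
∣p∩q∣+∣p∪q∣≡∣p∣+∣q∣ (true ∷ p) (false ∷ q) = trans (+-suc _ _) (cong suc (∣p∩q∣+∣p∪q∣≡∣p∣+∣q∣ p q))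
∣p∩q∣+∣p∪q∣≡∣p∣+∣q∣ (false ∷ p) (true ∷ q) =
  trans (+-suc _ _) (trans (cong suc (∣p∩q∣+∣p∪q∣≡∣p∣+∣q∣ p q)) (sym (+-suc _ _)))
∣p∩q∣+∣p∪q∣≡∣p∣+∣q∣ (false ∷ p) (false ∷ q) = ∣p∩q∣+∣p∪q∣≡∣p∣+∣q∣ p q

p⊆q∧∣p∣≡∣q∣⇒p≡q : ∀ {n} {p q : Subset n} → p ⊆ q → ∣ p ∣ ≡ ∣ q ∣ → p ≡ q
p⊆q∧∣p∣≡∣q∣⇒p≡q {p = []} {[]} _ _ = refl
p⊆q∧∣p∣≡∣q∣⇒p≡q {p = true ∷ p} {true ∷ q} p⊆q e =
  cong (true ∷_) (p⊆q∧∣p∣≡∣q∣⇒p≡q (drop-∷-⊆ p⊆q) (suc-injective e))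
p⊆q∧∣p∣≡∣q∣⇒p≡q {p = false ∷ p} {false ∷ q} p⊆q e =
  cong (false ∷_) (p⊆q∧∣p∣≡∣q∣⇒p≡q (drop-∷-⊆ p⊆q) e)
p⊆q∧∣p∣≡∣q∣⇒p≡q {p = true ∷ p} {false ∷ q} p⊆q _ with p⊆q here
... | ()
p⊆q∧∣p∣≡∣q∣⇒p≡q {p = false ∷ p} {true ∷ q} p⊆q e =
  ⊥-elim (<-irrefl e (s≤s (p⊆q⇒∣p∣≤∣q∣ (drop-∷-⊆ p⊆q))))

∣p∣≤∣p─q∣+∣q∣ : ∀ {n} (p q : Subset n) → ∣ p ∣ ≤ ∣ p ─ q ∣ + ∣ q ∣
∣p∣≤∣p─q∣+∣q∣ [] [] = z≤n
∣p∣≤∣p─q∣+∣q∣ (true ∷ p) (true ∷ q) = ≤-trans (s≤s (∣p∣≤∣p─q∣+∣q∣ p q)) (≤-reflexive (sym (+-suc _ _)))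
∣p∣≤∣p─q∣+∣q∣ (true ∷ p) (false ∷ q) = s≤s (∣p∣≤∣p─q∣+∣q∣ p q)
∣p∣≤∣p─q∣+∣q∣ (false ∷ p) (true ∷ q) = ≤-trans (∣p∣≤∣p─q∣+∣q∣ p q) (+-monoʳ-≤ ∣ p ─ q ∣ (n≤1+n ∣ q ∣))
∣p∣≤∣p─q∣+∣q∣ (false ∷ p) (false ∷ q) = ∣p∣≤∣p─q∣+∣q∣ p q

∣p∣≤1+∣p-x∣ : ∀ {n} (p : Subset n) (x : Fin n) → ∣ p ∣ ≤ suc ∣ p - x ∣
∣p∣≤1+∣p-x∣ p x = begin
  ∣ p ∣                  ≤⟨ ∣p∣≤∣p─q∣+∣q∣ p ⁅ x ⁆ ⟩
  ∣ p - x ∣ + ∣ ⁅ x ⁆ ∣  ≡⟨ cong (∣ p - x ∣ +_) (∣⁅x⁆∣≡1 x) ⟩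
  ∣ p - x ∣ + 1          ≡⟨ +-comm ∣ p - x ∣ 1 ⟩
  suc ∣ p - x ∣          ∎
  where open ≤-Reasoning

x∈p─q⇒x∉q : ∀ {n} (p q : Subset n) {x} → x ∈ p ─ q → x ∉ q
x∈p─q⇒x∉q (_ ∷ p) (_ ∷ q) (there x∈p─q) (there x∈q) = x∈p─q⇒x∉q p q x∈p─q x∈q
x∈p─q⇒x∉q (_ ∷ p) (true ∷ q) () here

x∈p-y⇒x≢y : ∀ {n} (p : Subset n) {x y} → x ∈ p - y → x ≢ y
x∈p-y⇒x≢y p {y = y} = x∉⁅y⁆⇒x≢y ∘ x∈p─q⇒x∉q p ⁅ y ⁆

∃-⊆-∣∣≡ : ∀ {n} (p : Subset n) m → m ≤ ∣ p ∣ → Σ (Subset n) λ t → t ⊆ p × ∣ t ∣ ≡ m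
∃-⊆-∣∣≡ [] zero _ = [] , ⊆-refl , refl
∃-⊆-∣∣≡ {suc n} (true ∷ p) zero _ = ⊥ , ⊆-min _ , ∣⊥∣≡0 (suc n)
∃-⊆-∣∣≡ (true ∷ p) (suc m) (s≤s m≤∣p∣) with ∃-⊆-∣∣≡ p m m≤∣p∣
... | t , t⊆p , ∣t∣≡m = true ∷ t , (λ { here → here ; (there x∈t) → there (t⊆p x∈t) }) , cong suc ∣t∣≡m
∃-⊆-∣∣≡ (false ∷ p) m m≤∣p∣ with ∃-⊆-∣∣≡ p m m≤∣p∣
... | t , t⊆p , ∣t∣≡m = false ∷ t , (λ { (there x∈t) → there (t⊆p x∈t) }) , ∣t∣≡m

r⊆p∩q⇒p≡q⊎∣p∩q∣≡∣r∣ : ∀ {n} {p q r : Subset n} → r ⊆ p → r ⊆ q →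
  ∣ p ∣ ≡ suc ∣ r ∣ → ∣ q ∣ ≡ suc ∣ r ∣ → p ≡ q ⊎ ∣ p ∩ q ∣ ≡ ∣ r ∣
r⊆p∩q⇒p≡q⊎∣p∩q∣≡∣r∣ {p = p} {q} r⊆p r⊆q ∣p∣ ∣q∣ with m≤n⇒m<n∨m≡n ∣p∩q∣≤1+∣r∣
  where ∣p∩q∣≤1+∣r∣ = ≤-trans (∣p∩q∣≤∣p∣ p q) (≤-reflexive ∣p∣)
... | inj₁ ∣p∩q∣≤∣r∣ = inj₂ (≤-antisym (≤-pred ∣p∩q∣≤∣r∣) (p⊆q⇒∣p∣≤∣q∣ (λ x∈r → x∈p∩q⁺ (r⊆p x∈r , r⊆q x∈r))))
... | inj₂ ∣p∩q∣≡1+∣r∣ = inj₁ (trans (sym (p⊆q∧∣p∣≡∣q∣⇒p≡q (p∩q⊆p p q) (trans ∣p∩q∣≡1+∣r∣ (sym ∣p∣))))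
                                      (p⊆q∧∣p∣≡∣q∣⇒p≡q (p∩q⊆q p q) (trans ∣p∩q∣≡1+∣r∣ (sym ∣q∣))))

∣p∪q∣≡2+∣p∩q∣ : ∀ {n d} (p q : Subset n) → ∣ p ∣ ≡ suc d → ∣ q ∣ ≡ suc d → ∣ p ∩ q ∣ ≡ d →
  ∣ p ∪ q ∣ ≡ suc (suc d)
∣p∪q∣≡2+∣p∩q∣ {d = d} p q ∣p∣ ∣q∣ ∣p∩q∣ = +-cancelˡ-≡ d _ _ (begin
  d + ∣ p ∪ q ∣          ≡⟨ cong (_+ ∣ p ∪ q ∣) (sym ∣p∩q∣) ⟩
  ∣ p ∩ q ∣ + ∣ p ∪ q ∣  ≡⟨ ∣p∩q∣+∣p∪q∣≡∣p∣+∣q∣ p q ⟩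
  ∣ p ∣ + ∣ q ∣          ≡⟨ cong₂ _+_ ∣p∣ ∣q∣ ⟩
  suc d + suc d          ≡⟨ sym (+-suc d (suc d)) ⟩
  d + suc (suc d)        ∎)
  where open ≡-Reasoning

occ≡0⇒lookup≢ : ∀ {k n} (v : Str k n) {c} i → occ c v ≡ 0 → lookup v i ≢ c
occ≡0⇒lookup≢ (x ∷ v) {c} i occ≡0 with x ≟ c
occ≡0⇒lookup≢ (x ∷ v) i () | yes _
occ≡0⇒lookup≢ (x ∷ v) zero occ≡0 | no x≢c = x≢c
occ≡0⇒lookup≢ (x ∷ v) (suc i) occ≡0 | no _ = occ≡0⇒lookup≢ v i occ≡0

occ≡1⇒lookup-injective : ∀ {k n} (v : Str k n) {c} i j → occ c v ≡ 1 →
  lookup v i ≡ c → lookup v j ≡ c → i ≡ j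
occ≡1⇒lookup-injective (x ∷ v) {c} i j occ≡1 vi≡c vj≡c with x ≟ c
... | yes _ with i | j
...   | zero  | zero  = refl
...   | zero  | suc j = contradiction vj≡c (occ≡0⇒lookup≢ v j (suc-injective occ≡1))
...   | suc i | _     = contradiction vi≡c (occ≡0⇒lookup≢ v i (suc-injective occ≡1))
occ≡1⇒lookup-injective (x ∷ v) zero    _       _ vi≡c _    | no x≢c = contradiction vi≡c x≢c
occ≡1⇒lookup-injective (x ∷ v) (suc i) zero    _ _    vj≡c | no x≢c = contradiction vj≡c x≢c
occ≡1⇒lookup-injective (x ∷ v) (suc i) (suc j) occ≡1 vi≡c vj≡c | no _ =
  cong suc (occ≡1⇒lookup-injective v i j occ≡1 vi≡c vj≡c)

size-toMultiset : ∀ {k} (S : Subset k) → size (toMultiset S) ≡ ∣ S ∣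
size-toMultiset [] = refl
size-toMultiset (true ∷ S) = cong suc (size-toMultiset S)
size-toMultiset (false ∷ S) = size-toMultiset S

lookup-toMultiset-∈ : ∀ {k} (S : Subset k) {x} → x ∈ S → lookup (toMultiset S) x ≡ 1
lookup-toMultiset-∈ (_ ∷ S) here = refl
lookup-toMultiset-∈ (_ ∷ S) (there x∈S) = lookup-toMultiset-∈ S x∈S

module _ {k n} {π : Multiset k → Str k n} where

  occ-π-∈ : IsPermAssignment n π → ∀ {S t} → ∣ S ∣ ≡ n → t ∈ S → occ t (π (toMultiset S)) ≡ 1
  occ-π-∈ perm {S} {t} ∣S∣ t∈S =
    trans (perm (toMultiset S) (trans (size-toMultiset S) ∣S∣) t) (lookup-toMultiset-∈ S t∈S)

  semiFrozen-lookup-h : ∀ {R S h w r} → SemiFrozenWith π R h w → R ⊆ S → ∣ S ∣ ≡ suc ∣ R ∣ →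
    r ∈ R → lookup (π (toMultiset S)) w ≢ r → lookup (π (toMultiset S)) (h r) ≡ r
  semiFrozen-lookup-h (_ , _ , frozen) R⊆S ∣S∣ r∈R πSw≢r with frozen _ r∈R _ R⊆S ∣S∣
  ... | inj₁ πShr≡r = πShr≡r
  ... | inj₂ πSw≡r = contradiction πSw≡r πSw≢r

  semiFrozen-agree : IsPermAssignment n π → ∀ {S R R' h h' w w' t} → ∣ S ∣ ≡ n →
    SemiFrozenWith π R h w → R ⊆ S → ∣ S ∣ ≡ suc ∣ R ∣ →
    SemiFrozenWith π R' h' w' → R' ⊆ S → ∣ S ∣ ≡ suc ∣ R' ∣ →
    t ∈ R → t ∈ R' → lookup (π (toMultiset S)) w ≢ t → lookup (π (toMultiset S)) w' ≢ t →
    h t ≡ h' t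
  semiFrozen-agree perm {S} ∣S∣≡n sf R⊆S ∣S∣ sf' R'⊆S ∣S∣' t∈R t∈R' πSw≢t πSw'≢t =
    occ≡1⇒lookup-injective (π (toMultiset S)) _ _ (occ-π-∈ perm ∣S∣≡n (R⊆S t∈R))
      (semiFrozen-lookup-h sf R⊆S ∣S∣ t∈R πSw≢t)
      (semiFrozen-lookup-h sf' R'⊆S ∣S∣' t∈R' πSw'≢t)

  semiFrozen-agree-on-all-but-two : IsPermAssignment n π → ∀ {Q R R' h h' w w' m} →
    SemiFrozenWith π R h w → SemiFrozenWith π R' h' w' →
    ∣ R ∪ R' ∣ ≡ n → ∣ R ∪ R' ∣ ≡ suc ∣ R ∣ → ∣ R ∪ R' ∣ ≡ suc ∣ R' ∣ →
    Q ⊆ R → Q ⊆ R' → ∣ Q ∣ ≡ suc (suc m) →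
    Σ (Subset k) λ T → T ⊆ Q × ∣ T ∣ ≡ m × (∀ t → t ∈ T → h t ≡ h' t)
  semiFrozen-agree-on-all-but-two perm {Q} {R} {R'} {w = w} {w'} {m} sf sf' ∣S∣≡n ∣S∣ ∣S∣' Q⊆R Q⊆R' ∣Q∣
    with ∃-⊆-∣∣≡ (Q - c - c') m m≤∣Q-c-c'∣
    where
    c  = lookup (π (toMultiset (R ∪ R'))) w
    c' = lookup (π (toMultiset (R ∪ R'))) w'
    m≤∣Q-c-c'∣ : m ≤ ∣ Q - c - c' ∣
    m≤∣Q-c-c'∣ = ≤-pred (≤-pred (begin
      suc (suc m)              ≡⟨ sym ∣Q∣ ⟩
      ∣ Q ∣                     ≤⟨ ∣p∣≤1+∣p-x∣ Q c ⟩
      suc ∣ Q - c ∣             ≤⟨ s≤s (∣p∣≤1+∣p-x∣ (Q - c) c') ⟩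
      suc (suc ∣ Q - c - c' ∣)  ∎))
      where open ≤-Reasoning
  ... | T , T⊆Q-c-c' , ∣T∣ = T , ⊆-trans T⊆Q-c-c' (⊆-trans (p─q⊆p _ _) (p─q⊆p _ _)) , ∣T∣ , agree
    where
    agree : ∀ t → t ∈ T → _ ≡ _
    agree t t∈T =
      semiFrozen-agree perm ∣S∣≡n sf (p⊆p∪q R') ∣S∣ sf' (q⊆p∪q R R') ∣S∣'
        (Q⊆R t∈Q) (Q⊆R' t∈Q) (≢-sym (x∈p-y⇒x≢y Q t∈Q-c)) (≢-sym (x∈p-y⇒x≢y _ t∈Q-c-c'))
      where
      t∈Q-c-c' = T⊆Q-c-c' t∈T
      t∈Q-c = p─q⊆p _ _ t∈Q-c-c'
      t∈Q = p─q⊆p _ _ t∈Q-c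

lemma8 : (n k : ℕ) → 4 ≤ n → 1 ≤ k →
    (π : Multiset k → Str k n) → IsPermAssignment n π → MaxDistortionAtMost π 3 →
    (K' : Subset k) → (h : Subset k → Fin k → Fin n) → (w : Subset k → Fin n) →
    (∀ (R : Subset k) → R ⊆ K' → ∣ R ∣ ≡ n ∸ 1 → SemiFrozenWith π R (h R) (w R)) →
    ∀ (Q R R' : Subset k) → ∣ Q ∣ ≡ n ∸ 2 →
    Q ⊆ R → R ⊆ K' → ∣ R ∣ ≡ n ∸ 1 →
    Q ⊆ R' → R' ⊆ K' → ∣ R' ∣ ≡ n ∸ 1 →
    Σ (Subset k) (λ T → T ⊆ Q × ∣ T ∣ ≡ n ∸ 4 × (∀ t → t ∈ T → h R t ≡ h R' t))
lemma8 .(suc (suc (suc (suc m)))) k (s≤s (s≤s (s≤s (s≤s {n = m} _)))) _ π perm _ K' h w semiFrozen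
       Q R R' ∣Q∣ Q⊆R R⊆K' ∣R∣ Q⊆R' R'⊆K' ∣R'∣
  with r⊆p∩q⇒p≡q⊎∣p∩q∣≡∣r∣ Q⊆R Q⊆R' (trans ∣R∣ (cong suc (sym ∣Q∣))) (trans ∣R'∣ (cong suc (sym ∣Q∣)))
... | inj₁ refl with ∃-⊆-∣∣≡ Q m (≤-trans (m≤n+m m 2) (≤-reflexive (sym ∣Q∣)))
...   | T , T⊆Q , ∣T∣ = T , T⊆Q , ∣T∣ , λ _ _ → refl
lemma8 _ _ _ _ π perm _ K' h w semiFrozen Q R R' ∣Q∣ Q⊆R R⊆K' ∣R∣ Q⊆R' R'⊆K' ∣R'∣ | inj₂ ∣R∩R'∣ =
  semiFrozen-agree-on-all-but-two {π = π} perm (semiFrozen R R⊆K' ∣R∣) (semiFrozen R' R'⊆K' ∣R'∣)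
    ∣R∪R'∣ (trans ∣R∪R'∣ (cong suc (sym ∣R∣))) (trans ∣R∪R'∣ (cong suc (sym ∣R'∣))) Q⊆R Q⊆R' ∣Q∣
  where
  ∣R∪R'∣ = ∣p∪q∣≡2+∣p∩q∣ R R' ∣R∣ ∣R'∣ (trans ∣R∩R'∣ ∣Q∣)
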